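{- Let $\mathbf A$ be a modular pseudo-Kleene lattice and $x,y\in A$. Then $x\,\mathrm C\,y$ if and only if the subalgebra $\mathbf{Sg}(x,y)$ of $\mathbf A$ generated by $\{x,y\}$ is a Kleene lattice (i.e. is distributive).
   Context: A pseudo-Kleene lattice is an algebra $(A,\land,\lor,{}',0,1)$ with $(A,\land,\lor,0,1)$ a bounded lattice, ${}'$ an antitone involution, and $x\land x'\leq y\lor y'$; it is modular if its lattice reduct is modular. For $a,b\in A$, $a\,\mathrm C\,b$ ($a$ commutes with $b$) means: (C1) $a\land(b\lor b')=(a\land b)\lor(a\land b')$; (C2) $b\land(a\lor a')=(b\land a)\lor(b\land a')$; (C3) $a\land a'=((a\land a')\land b)\lor((a\land a')\land b')$. A Kleene lattice is a distributive pseudo-Kleene lattice. -}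

module Defs where

open import Level using (Level; _⊔_; suc)
open import Data.Product using (Σ; _×_; _,_)
open import Relation.Binary.Core using (Rel)
open import Algebra.Core using (Op₁; Op₂)
open import Algebra.Lattice.Structures using (IsLattice)

record PseudoKleeneLattice (c ℓ : Level) : Set (suc (c ⊔ ℓ)) where
  infixr 7 _∧_
  infixr 6 _∨_
  infix  4 _≈_ _≤_
  field
    Carrier   : Set c
    _≈_       : Rel Carrier ℓ
    _∨_       : Op₂ Carrier
    _∧_       : Op₂ Carrier
    _′        : Op₁ Carrier
    ⊥         : Carrier
    ⊤         : Carrier
    isLattice : IsLattice _≈_ _∨_ _∧_

  open IsLattice isLattice public

  _≤_ : Rel Carrier ℓ
  x ≤ y = (x ∧ y) ≈ x

  field
    ⊥-least    : ∀ x → ⊥ ≤ x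
    ⊤-greatest : ∀ x → x ≤ ⊤
    ′-cong     : ∀ {x y} → x ≈ y → (x ′) ≈ (y ′)
    involutive : ∀ x → ((x ′) ′) ≈ x
    antitone   : ∀ {x y} → x ≤ y → (y ′) ≤ (x ′)
    kleene     : ∀ x y → (x ∧ (x ′)) ≤ (y ∨ (y ′))

module _ {c ℓ : Level} (A : PseudoKleeneLattice c ℓ) where
  open PseudoKleeneLattice A

  IsModular : Set (c ⊔ ℓ)
  IsModular = ∀ x y z → x ≤ z → (x ∨ (y ∧ z)) ≈ ((x ∨ y) ∧ z)

  -- the commutation relation x C y: conditions (C1), (C2), (C3)
  _C_ : Carrier → Carrier → Set ℓ
  a C b =
      ((a ∧ (b ∨ (b ′))) ≈ ((a ∧ b) ∨ (a ∧ (b ′))))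
    × ((b ∧ (a ∨ (a ′))) ≈ ((b ∧ a) ∨ (b ∧ (a ′))))
    × ((a ∧ (a ′)) ≈ (((a ∧ (a ′)) ∧ b) ∨ ((a ∧ (a ′)) ∧ (b ′))))

data Term₂ : Set where
  var₀ var₁ : Term₂
  _∧ₜ_ _∨ₜ_ : Term₂ → Term₂ → Term₂
  _′ₜ       : Term₂ → Term₂
  ⊥ₜ ⊤ₜ     : Term₂

module _ {c ℓ : Level} (A : PseudoKleeneLattice c ℓ) where
  open PseudoKleeneLattice A

  ⟦_⟧[_,_] : Term₂ → Carrier → Carrier → Carrier
  ⟦ var₀ ⟧[ x , y ] = x
  ⟦ var₁ ⟧[ x , y ] = y
  ⟦ s ∧ₜ t ⟧[ x , y ] = ⟦ s ⟧[ x , y ] ∧ ⟦ t ⟧[ x , y ]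
  ⟦ s ∨ₜ t ⟧[ x , y ] = ⟦ s ⟧[ x , y ] ∨ ⟦ t ⟧[ x , y ]
  ⟦ s ′ₜ ⟧[ x , y ] = ⟦ s ⟧[ x , y ] ′
  ⟦ ⊥ₜ ⟧[ x , y ] = ⊥
  ⟦ ⊤ₜ ⟧[ x , y ] = ⊤

  -- membership in the subalgebra Sg(x,y) generated by {x,y}:
  -- its elements are exactly the values of binary terms at (x,y)
  InSg : Carrier → Carrier → Carrier → Set ℓ
  InSg x y a = Σ Term₂ (λ t → ⟦ t ⟧[ x , y ] ≈ a)

  -- Sg(x,y) is a Kleene lattice, i.e. its lattice reduct is distributive
  -- (it is automatically a pseudo-Kleene lattice, being a subalgebra)
  SgIsKleene : Carrier → Carrier → Set (c ⊔ ℓ)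
  SgIsKleene x y = ∀ a b d → InSg x y a → InSg x y b → InSg x y d →
    (a ∧ (b ∨ d)) ≈ ((a ∧ b) ∨ (a ∧ d))

{-# OPTIONS --safe #-}
-- Write p = x ∧ x′ and q = y ∧ y′. Under (C1)–(C3) the fourteen elements
--   ⊤, y′, y, x′, x, x′∧y′, x′∧y, x∧y′, x∧y, x′∧q, x∧q, p∧y′, p∧y, p∧q
-- form a coherent family: each meets the join of the later ones below the join of the
-- later ones lying under it. In a modular lattice this makes I ↦ ⋁ᵢ∈I gᵢ a lattice
-- homomorphism from the index sets closed under that "lying under" relation, a
-- distributive lattice of sets, into A. Its image contains x and y, and is closed under ′
-- because ′ turns a join of generators into a meet of complements of generators, each of
-- which is again in the image. So the image contains Sg(x,y), which is thus distributive.
-- Conversely, (C1)–(C3) are instances of distributivity in Sg(x,y); (C3) uses the Kleene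
-- condition x ∧ x′ ≤ y ∨ y′.
module Submission where

open import Defs
open import Level using (Level)
open import Function using (_∘_)
open import Function.Bundles using (_⇔_; mk⇔)
open import Data.Nat using (ℕ; zero; suc)
open import Data.Fin using (Fin; zero; suc; #_)
open import Data.Bool using (true; false; if_then_else_)
open import Data.Vec using ([]; _∷_; here; there)
open import Data.Product using (Σ; _×_; _,_; proj₁; proj₂)
open import Data.Sum using ([_,_])
open import Data.Empty using (⊥-elim)
open import Data.Unit.Polymorphic using (tt) renaming (⊤ to Unit)
open import Data.Fin.Subset using (Subset; _∈_; _⊆_; _∩_; _∪_)
  renaming (⊥ to ∅; ⊤ to full)
open import Data.Fin.Subset.Properties
  using (_∈?_; _⊆?_; ⊆⊤; ∉⊥; p⊆p∪q; q⊆p∪q; p∩q⊆p; p∩q⊆q; x∈p∩q⁺; x∈p∪q⁻; ∩-distribˡ-∪)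
open import Relation.Nullary.Decidable using (Dec; yes; _×-dec_; True; toWitness)
open import Relation.Binary.Bundles using (Setoid)
open import Relation.Binary.PropositionalEquality using (cong)
import Relation.Binary.Reasoning.Setoid as SetoidReasoning
open import Algebra.Lattice.Bundles using (Lattice)
import Algebra.Lattice.Properties.Lattice as LatticeProperties

module Order {c ℓ : Level} (A : PseudoKleeneLattice c ℓ) where
  open PseudoKleeneLattice A

  lattice : Lattice c ℓ
  lattice = record { isLattice = isLattice }

  setoid : Setoid c ℓ
  setoid = record { isEquivalence = isEquivalence }

  open LatticeProperties lattice using (∧-idem)

  ≤-reflexive : ∀ {a b} → a ≈ b → a ≤ b
  ≤-reflexive {a} a≈b = trans (∧-congˡ (sym a≈b)) (∧-idem a)

  ≤-refl : ∀ {a} → a ≤ a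
  ≤-refl = ≤-reflexive refl

  infixr 5 _⟫_
  _⟫_ : ∀ {a b d} → a ≤ b → b ≤ d → a ≤ d
  _⟫_ {a} {b} {d} a≤b b≤d =
    trans (∧-congʳ (sym a≤b)) (trans (∧-assoc a b d) (trans (∧-congˡ b≤d) a≤b))

  ≤-antisym : ∀ {a b} → a ≤ b → b ≤ a → a ≈ b
  ≤-antisym {a} {b} a≤b b≤a = trans (sym a≤b) (trans (∧-comm a b) b≤a)

  x∧y≤y : ∀ {a b} → a ∧ b ≤ b
  x∧y≤y {a} {b} = trans (∧-assoc a b b) (∧-congˡ (≤-refl {b}))

  x∧y≤x : ∀ {a b} → a ∧ b ≤ a
  x∧y≤x {a} {b} = ≤-reflexive (∧-comm a b) ⟫ x∧y≤y

  ∧-greatest : ∀ {w a b} → w ≤ a → w ≤ b → w ≤ a ∧ b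
  ∧-greatest {w} {a} {b} w≤a w≤b = trans (sym (∧-assoc w a b)) (trans (∧-congʳ w≤a) w≤b)

  x≤x∨y : ∀ {a b} → a ≤ a ∨ b
  x≤x∨y {a} {b} = ∧-absorbs-∨ a b

  y≤x∨y : ∀ {a b} → b ≤ a ∨ b
  y≤x∨y {a} {b} = trans (∧-congˡ (∨-comm a b)) (∧-absorbs-∨ b a)

  ∨-least : ∀ {a b w} → a ≤ w → b ≤ w → a ∨ b ≤ w
  ∨-least {a} {b} {w} a≤w b≤w = trans (∧-congˡ (sym a∨b∨w≈w)) (∧-absorbs-∨ (a ∨ b) w)
    where
    ≤⇒∨≈ : ∀ {u v} → u ≤ v → u ∨ v ≈ v
    ≤⇒∨≈ {u} {v} u≤v = trans (∨-congʳ (sym u≤v))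
      (trans (∨-comm (u ∧ v) v) (trans (∨-congˡ (∧-comm u v)) (∨-absorbs-∧ v u)))
    a∨b∨w≈w : (a ∨ b) ∨ w ≈ w
    a∨b∨w≈w = trans (∨-assoc a b w) (trans (∨-congˡ (≤⇒∨≈ b≤w)) (≤⇒∨≈ a≤w))

  ∧-monotonic : ∀ {a b d e} → a ≤ b → d ≤ e → a ∧ d ≤ b ∧ e
  ∧-monotonic a≤b d≤e = ∧-greatest (x∧y≤x ⟫ a≤b) (x∧y≤y ⟫ d≤e)

  ∨-monotonic : ∀ {a b d e} → a ≤ b → d ≤ e → a ∨ d ≤ b ∨ e
  ∨-monotonic a≤b d≤e = ∨-least (a≤b ⟫ x≤x∨y) (d≤e ⟫ y≤x∨y)

  ∧-comm≤ : ∀ {a b} → a ∧ b ≤ b ∧ a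
  ∧-comm≤ = ∧-greatest x∧y≤y x∧y≤x

  ∨-comm≤ : ∀ {a b} → a ∨ b ≤ b ∨ a
  ∨-comm≤ = ∨-least y≤x∨y x≤x∨y

  ⊥∨x≈x : ∀ {a} → ⊥ ∨ a ≈ a
  ⊥∨x≈x = ≤-antisym (∨-least (⊥-least _) ≤-refl) y≤x∨y

  x′′≤x : ∀ {a} → a ′ ′ ≤ a
  x′′≤x {a} = ≤-reflexive (involutive a)

  x≤x′′ : ∀ {a} → a ≤ a ′ ′
  x≤x′′ {a} = ≤-reflexive (sym (involutive a))

  ≤′-swap : ∀ {a b} → a ≤ b ′ → b ≤ a ′
  ≤′-swap a≤b′ = x≤x′′ ⟫ antitone a≤b′

  ′≤-swap : ∀ {a b} → a ′ ≤ b → b ′ ≤ a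
  ′≤-swap a′≤b = antitone a′≤b ⟫ x′′≤x

  ′-∨ : ∀ {a b} → (a ∨ b) ′ ≈ a ′ ∧ b ′
  ′-∨ = ≤-antisym (∧-greatest (antitone x≤x∨y) (antitone y≤x∨y))
                  (≤′-swap (∨-least (≤′-swap x∧y≤x) (≤′-swap x∧y≤y)))

  ′-∧ : ∀ {a b} → (a ∧ b) ′ ≈ a ′ ∨ b ′
  ′-∧ {a} {b} = ≤-antisym
    (′≤-swap (≤-reflexive ′-∨ ⟫ ∧-monotonic x′′≤x x′′≤x))
    (∨-least (antitone x∧y≤x) (antitone x∧y≤y))

  ′-∨≥ : ∀ {a b} → a ′ ∧ b ′ ≤ (a ∨ b) ′
  ′-∨≥ = ≤-reflexive (sym ′-∨)

  ′-∧≤ : ∀ {a b} → (a ∧ b) ′ ≤ a ′ ∨ b ′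
  ′-∧≤ = ≤-reflexive ′-∧

  ′-∧≥ : ∀ {a b} → a ′ ∨ b ′ ≤ (a ∧ b) ′
  ′-∧≥ = ≤-reflexive (sym ′-∧)

  ′-x∨x′ : ∀ {a} → (a ∨ a ′) ′ ≈ a ∧ a ′
  ′-x∨x′ {a} = trans ′-∨ (trans (∧-congˡ (involutive a)) (∧-comm (a ′) a))

  ′-x∧x′ : ∀ {a} → (a ∧ a ′) ′ ≈ a ∨ a ′
  ′-x∧x′ {a} = trans ′-∧ (trans (∨-congˡ (involutive a)) (∨-comm (a ′) a))

  ⊥′≈⊤ : ⊥ ′ ≈ ⊤
  ⊥′≈⊤ = ≤-antisym (⊤-greatest _) (≤′-swap (⊥-least _))

  ⊤′≈⊥ : ⊤ ′ ≈ ⊥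
  ⊤′≈⊥ = ≤-antisym (′≤-swap (⊤-greatest _)) (⊥-least _)

module Modular {c ℓ : Level} (A : PseudoKleeneLattice c ℓ) (modular : IsModular A) where
  open PseudoKleeneLattice A
  open Order A

  modular≤ : ∀ {a b d} → a ≤ d → (a ∨ b) ∧ d ≤ a ∨ (b ∧ d)
  modular≤ {a} {b} {d} a≤d = ≤-reflexive (sym (modular a b d a≤d))

  ≤∨-refine : ∀ {u a b d} → u ≤ a ∨ b → (a ∨ u) ∧ b ≤ d → u ≤ a ∨ d
  ≤∨-refine u≤a∨b [a∨u]∧b≤d =
    ∧-greatest u≤a∨b y≤x∨y ⟫ modular≤ x≤x∨y ⟫ ∨-monotonic ≤-refl (∧-comm≤ ⟫ [a∨u]∧b≤d)

module Representation {c ℓ : Level} (A : PseudoKleeneLattice c ℓ) (modular : IsModular A) where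
  open PseudoKleeneLattice A
  open Order A
  open Modular A modular

  infixr 5 _⟨_⟩∷_
  data Family : ℕ → Set c where
    []      : Family zero
    _⟨_⟩∷_ : ∀ {n} → Carrier → Subset n → Family n → Family (suc n)

  _!_ : ∀ {n} → Family n → Fin n → Carrier
  (g ⟨ d ⟩∷ gs) ! zero  = g
  (g ⟨ d ⟩∷ gs) ! suc i = gs ! i

  ⋁ : ∀ {n} → Family n → Subset n → Carrier
  ⋁ [] [] = ⊥
  ⋁ (g ⟨ d ⟩∷ gs) (s ∷ I) = (if s then g else ⊥) ∨ ⋁ gs I

  AllBelow : ∀ {n} → Family n → Subset n → Carrier → Set ℓ
  AllBelow [] [] w = Unit
  AllBelow (g ⟨ d ⟩∷ gs) (false ∷ I) w = AllBelow gs I w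
  AllBelow (g ⟨ d ⟩∷ gs) (true ∷ I) w = g ≤ w × AllBelow gs I w

  allBelow : ∀ {n} (gs : Family n) (I : Subset n) {w} →
             (∀ {i} → i ∈ I → gs ! i ≤ w) → AllBelow gs I w
  allBelow [] [] below = tt
  allBelow (g ⟨ d ⟩∷ gs) (false ∷ I) below = allBelow gs I (below ∘ there)
  allBelow (g ⟨ d ⟩∷ gs) (true ∷ I) below = below here , allBelow gs I (below ∘ there)

  ⋁-least : ∀ {n} (gs : Family n) (I : Subset n) {w} → AllBelow gs I w → ⋁ gs I ≤ w
  ⋁-least [] [] _ = ⊥-least _
  ⋁-least (g ⟨ d ⟩∷ gs) (false ∷ I) below = ∨-least (⊥-least _) (⋁-least gs I below)
  ⋁-least (g ⟨ d ⟩∷ gs) (true ∷ I) (g≤w , below) = ∨-least g≤w (⋁-least gs I below)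

  ⋁-upper : ∀ {n} (gs : Family n) (I : Subset n) {i} → i ∈ I → gs ! i ≤ ⋁ gs I
  ⋁-upper (g ⟨ d ⟩∷ gs) (true ∷ I) here = x≤x∨y
  ⋁-upper (g ⟨ d ⟩∷ gs) (s ∷ I) (there i∈I) = ⋁-upper gs I i∈I ⟫ y≤x∨y

  ⋁-upper-at : ∀ {n} (gs : Family n) (I : Subset n) i {i∈I : True (i ∈? I)} → gs ! i ≤ ⋁ gs I
  ⋁-upper-at gs I i {i∈I} = ⋁-upper gs I (toWitness i∈I)

  ⋁-mono : ∀ {n} (gs : Family n) {I K : Subset n} → I ⊆ K → ⋁ gs I ≤ ⋁ gs K
  ⋁-mono gs {I} {K} I⊆K = ⋁-least gs I (allBelow gs I (⋁-upper gs K ∘ I⊆K))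

  ⋁-∪ : ∀ {n} (gs : Family n) (I K : Subset n) → ⋁ gs (I ∪ K) ≈ ⋁ gs I ∨ ⋁ gs K
  ⋁-∪ gs I K = ≤-antisym
    (⋁-least gs (I ∪ K) (allBelow gs (I ∪ K)
      ([ (λ i∈I → ⋁-upper gs I i∈I ⟫ x≤x∨y) , (λ i∈K → ⋁-upper gs K i∈K ⟫ y≤x∨y) ] ∘ x∈p∪q⁻ I K)))
    (∨-least (⋁-mono gs (p⊆p∪q K)) (⋁-mono gs (q⊆p∪q I K)))

  Closed : ∀ {n} → Family n → Subset n → Set
  Closed [] [] = Unit
  Closed (g ⟨ d ⟩∷ gs) (false ∷ I) = Closed gs I
  Closed (g ⟨ d ⟩∷ gs) (true ∷ I) = d ⊆ I × Closed gs I

  closed? : ∀ {n} (gs : Family n) (I : Subset n) → Dec (Closed gs I)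
  closed? [] [] = yes tt
  closed? (g ⟨ d ⟩∷ gs) (false ∷ I) = closed? gs I
  closed? (g ⟨ d ⟩∷ gs) (true ∷ I) = d ⊆? I ×-dec closed? gs I

  Closed-tail : ∀ {n g d} {gs : Family n} s {I} → Closed (g ⟨ d ⟩∷ gs) (s ∷ I) → Closed gs I
  Closed-tail false closed = closed
  Closed-tail true (_ , closed) = closed

  Closed-∅ : ∀ {n} (gs : Family n) → Closed gs ∅
  Closed-∅ [] = tt
  Closed-∅ (g ⟨ d ⟩∷ gs) = Closed-∅ gs

  Closed-full : ∀ {n} (gs : Family n) → Closed gs full
  Closed-full [] = tt
  Closed-full (g ⟨ d ⟩∷ gs) = ⊆⊤ , Closed-full gs

  Closed-∩ : ∀ {n} (gs : Family n) {I K} → Closed gs I → Closed gs K → Closed gs (I ∩ K)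
  Closed-∩ [] {[]} {[]} _ _ = tt
  Closed-∩ (g ⟨ d ⟩∷ gs) {false ∷ I} {s ∷ K} CI CK = Closed-∩ gs CI (Closed-tail s CK)
  Closed-∩ (g ⟨ d ⟩∷ gs) {true ∷ I} {false ∷ K} (_ , CI) CK = Closed-∩ gs CI CK
  Closed-∩ (g ⟨ d ⟩∷ gs) {true ∷ I} {true ∷ K} (d⊆I , CI) (d⊆K , CK) =
    (λ i∈d → x∈p∩q⁺ (d⊆I i∈d , d⊆K i∈d)) , Closed-∩ gs CI CK

  Closed-∪ : ∀ {n} (gs : Family n) {I K} → Closed gs I → Closed gs K → Closed gs (I ∪ K)
  Closed-∪ [] {[]} {[]} _ _ = tt
  Closed-∪ (g ⟨ d ⟩∷ gs) {false ∷ I} {false ∷ K} CI CK = Closed-∪ gs CI CK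
  Closed-∪ (g ⟨ d ⟩∷ gs) {false ∷ I} {true ∷ K} CI (d⊆K , CK) =
    q⊆p∪q I K ∘ d⊆K , Closed-∪ gs CI CK
  Closed-∪ (g ⟨ d ⟩∷ gs) {true ∷ I} {s ∷ K} (d⊆I , CI) CK =
    p⊆p∪q K ∘ d⊆I , Closed-∪ gs CI (Closed-tail s CK)

  HeadCoherent : ∀ {n} → Family (suc n) → Set ℓ
  HeadCoherent (g ⟨ d ⟩∷ gs) = g ∧ ⋁ gs full ≤ ⋁ gs d

  Coherent : ∀ {n} → Family n → Set ℓ
  Coherent [] = Unit
  Coherent (g ⟨ d ⟩∷ gs) = HeadCoherent (g ⟨ d ⟩∷ gs) × Coherent gs

  -- By modularity (⋁J ∨ g) ∧ (⋁J ∨ ⋁L) = ⋁J ∨ (g ∧ (⋁J ∨ ⋁L)), and coherence puts that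
  -- last meet below ⋁d ≤ ⋁J.
  head-absorbed : ∀ {n g d} (gs : Family n) {J L} → HeadCoherent (g ⟨ d ⟩∷ gs) → d ⊆ J →
                  (g ∨ ⋁ gs J) ∧ ⋁ gs L ≤ ⋁ gs J
  head-absorbed gs coherent d⊆J =
    ∧-monotonic ∨-comm≤ y≤x∨y ⟫ modular≤ x≤x∨y
    ⟫ ∨-least ≤-refl
        (∧-monotonic ≤-refl (∨-least (⋁-mono gs ⊆⊤) (⋁-mono gs ⊆⊤)) ⟫ coherent ⟫ ⋁-mono gs d⊆J)

  ⋁-∧≤ : ∀ {n} (gs : Family n) → Coherent gs → ∀ {I K} → Closed gs I → Closed gs K →
         ⋁ gs I ∧ ⋁ gs K ≤ ⋁ gs (I ∩ K)
  ⋁-∧≤ [] _ {[]} {[]} _ _ = x∧y≤x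
  ⋁-∧≤ (g ⟨ d ⟩∷ gs) (coh , cohs) {false ∷ I} {false ∷ K} CI CK =
    ∧-monotonic (≤-reflexive ⊥∨x≈x) (≤-reflexive ⊥∨x≈x) ⟫ ⋁-∧≤ gs cohs CI CK ⟫ y≤x∨y
  ⋁-∧≤ (g ⟨ d ⟩∷ gs) (coh , cohs) {true ∷ I} {false ∷ K} (d⊆I , CI) CK =
    ∧-monotonic ≤-refl (≤-reflexive ⊥∨x≈x) ⟫ ∧-greatest (head-absorbed gs coh d⊆I) x∧y≤y
    ⟫ ⋁-∧≤ gs cohs CI CK ⟫ y≤x∨y
  ⋁-∧≤ (g ⟨ d ⟩∷ gs) (coh , cohs) {false ∷ I} {true ∷ K} CI (d⊆K , CK) =
    ∧-monotonic (≤-reflexive ⊥∨x≈x) ≤-refl ⟫ ∧-greatest x∧y≤x (∧-comm≤ ⟫ head-absorbed gs coh d⊆K)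
    ⟫ ⋁-∧≤ gs cohs CI CK ⟫ y≤x∨y
  ⋁-∧≤ (g ⟨ d ⟩∷ gs) (coh , cohs) {true ∷ I} {true ∷ K} (d⊆I , CI) (d⊆K , CK) =
    modular≤ x≤x∨y
    ⟫ ∨-monotonic ≤-refl
        (∧-greatest x∧y≤x (∧-comm≤ ⟫ head-absorbed gs coh d⊆K) ⟫ ⋁-∧≤ gs cohs CI CK)

  ⋁-∩ : ∀ {n} (gs : Family n) → Coherent gs → ∀ {I K} → Closed gs I → Closed gs K →
        ⋁ gs I ∧ ⋁ gs K ≈ ⋁ gs (I ∩ K)
  ⋁-∩ gs coherent {I} {K} CI CK = ≤-antisym (⋁-∧≤ gs coherent CI CK)
    (∧-greatest (⋁-mono gs (p∩q⊆p I K)) (⋁-mono gs (p∩q⊆q I K)))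

  ⋁-distrib : ∀ {n} (gs : Family n) → Coherent gs → ∀ {I K M} →
              Closed gs I → Closed gs K → Closed gs M →
              ⋁ gs I ∧ (⋁ gs K ∨ ⋁ gs M) ≈ (⋁ gs I ∧ ⋁ gs K) ∨ (⋁ gs I ∧ ⋁ gs M)
  ⋁-distrib gs coherent {I} {K} {M} CI CK CM = begin
    ⋁ gs I ∧ (⋁ gs K ∨ ⋁ gs M)             ≈⟨ ∧-congˡ (sym (⋁-∪ gs K M)) ⟩
    ⋁ gs I ∧ ⋁ gs (K ∪ M)                  ≈⟨ ⋁-∩ gs coherent CI (Closed-∪ gs CK CM) ⟩
    ⋁ gs (I ∩ (K ∪ M))                     ≡⟨ cong (⋁ gs) (∩-distribˡ-∪ I K M) ⟩
    ⋁ gs ((I ∩ K) ∪ (I ∩ M))               ≈⟨ ⋁-∪ gs (I ∩ K) (I ∩ M) ⟩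
    ⋁ gs (I ∩ K) ∨ ⋁ gs (I ∩ M)            ≈⟨ ∨-cong (⋁-∩ gs coherent CI CK) (⋁-∩ gs coherent CI CM) ⟨
    (⋁ gs I ∧ ⋁ gs K) ∨ (⋁ gs I ∧ ⋁ gs M)  ∎
    where open SetoidReasoning setoid

  module Representing {N} (gs : Family N) (coherent : Coherent gs) (⊤≤⋁full : ⊤ ≤ ⋁ gs full) where

    Represented : Carrier → Set ℓ
    Represented a = Σ (Subset N) λ I → Closed gs I × a ≈ ⋁ gs I

    Represented-resp : ∀ {a b} → a ≈ b → Represented a → Represented b
    Represented-resp a≈b (I , CI , a≈⋁I) = I , CI , trans (sym a≈b) a≈⋁I

    Represented-⊥ : Represented ⊥
    Represented-⊥ =
      ∅ , Closed-∅ gs , ≤-antisym (⊥-least _) (⋁-least gs ∅ (allBelow gs ∅ (⊥-elim ∘ ∉⊥)))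

    Represented-⊤ : Represented ⊤
    Represented-⊤ = full , Closed-full gs , ≤-antisym ⊤≤⋁full (⊤-greatest _)

    Represented-∨ : ∀ {a b} → Represented a → Represented b → Represented (a ∨ b)
    Represented-∨ (I , CI , a≈) (K , CK , b≈) =
      I ∪ K , Closed-∪ gs CI CK , trans (∨-cong a≈ b≈) (sym (⋁-∪ gs I K))

    Represented-∧ : ∀ {a b} → Represented a → Represented b → Represented (a ∧ b)
    Represented-∧ (I , CI , a≈) (K , CK , b≈) =
      I ∩ K , Closed-∩ gs CI CK , trans (∧-cong a≈ b≈) (⋁-∩ gs coherent CI CK)

    Represented-′∧ : ∀ {a b} → Represented (a ′) → Represented (b ′) → Represented ((a ∧ b) ′)
    Represented-′∧ a′ b′ = Represented-resp (sym ′-∧) (Represented-∨ a′ b′)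

    Represented-member : ∀ I i {i∈I : True (i ∈? I)} {closed : True (closed? gs I)} →
                         AllBelow gs I (gs ! i) → Represented (gs ! i)
    Represented-member I i {i∈I} {closed} below =
      I , toWitness closed , ≤-antisym (⋁-upper gs I (toWitness i∈I)) (⋁-least gs I below)

    ComplementsRepresented : ∀ {n} → Family n → Set ℓ
    ComplementsRepresented [] = Unit
    ComplementsRepresented (h ⟨ d ⟩∷ hs) = Represented (h ′) × ComplementsRepresented hs

    Represented-′⋁ : ∀ {n} (hs : Family n) → ComplementsRepresented hs →
                     ∀ I → Represented (⋁ hs I ′)
    Represented-′⋁ [] _ [] = Represented-resp (sym ⊥′≈⊤) Represented-⊤
    Represented-′⋁ (h ⟨ d ⟩∷ hs) (h′ , hs′) (true ∷ I) =
      Represented-resp (sym ′-∨) (Represented-∧ h′ (Represented-′⋁ hs hs′ I))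
    Represented-′⋁ (h ⟨ d ⟩∷ hs) (h′ , hs′) (false ∷ I) =
      Represented-resp (′-cong (sym ⊥∨x≈x)) (Represented-′⋁ hs hs′ I)

    Represented-′ : ComplementsRepresented gs → ∀ {a} → Represented a → Represented (a ′)
    Represented-′ gs′ (I , _ , a≈⋁I) =
      Represented-resp (′-cong (sym a≈⋁I)) (Represented-′⋁ gs gs′ I)

    Represented-distrib : ∀ {a b d} → Represented a → Represented b → Represented d →
                          a ∧ (b ∨ d) ≈ (a ∧ b) ∨ (a ∧ d)
    Represented-distrib (I , CI , a≈) (K , CK , b≈) (M , CM , d≈) =
      trans (∧-cong a≈ (∨-cong b≈ d≈))
        (trans (⋁-distrib gs coherent CI CK CM)
          (sym (∨-cong (∧-cong a≈ b≈) (∧-cong a≈ d≈))))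

    sgIsKleene : ComplementsRepresented gs → ∀ {x y} → Represented x → Represented y →
                 SgIsKleene A x y
    sgIsKleene gs′ {x} {y} x-rep y-rep a b d (s , ⟦s⟧≈a) (t , ⟦t⟧≈b) (u , ⟦u⟧≈d) =
      Represented-distrib (Represented-resp ⟦s⟧≈a (term s)) (Represented-resp ⟦t⟧≈b (term t))
        (Represented-resp ⟦u⟧≈d (term u))
      where
      term : ∀ t → Represented (⟦_⟧[_,_] A t x y)
      term var₀ = x-rep
      term var₁ = y-rep
      term (s ∧ₜ t) = Represented-∧ (term s) (term t)
      term (s ∨ₜ t) = Represented-∨ (term s) (term t)
      term (t ′ₜ) = Represented-′ gs′ (term t)
      term ⊥ₜ = Represented-⊥
      term ⊤ₜ = Represented-⊤

module Commuting {c ℓ : Level} (A : PseudoKleeneLattice c ℓ) (modular : IsModular A)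
                 (x y : PseudoKleeneLattice.Carrier A) (commute : _C_ A x y) where
  open PseudoKleeneLattice A
  open Order A
  open Modular A modular

  x′ y′ p q P Q a₁ a₂ a₃ a₄ : Carrier
  x′ = x ′
  y′ = y ′
  p = x ∧ x′
  q = y ∧ y′
  P = x ∨ x′
  Q = y ∨ y′
  a₁ = x ∧ y
  a₂ = x ∧ y′
  a₃ = x′ ∧ y
  a₄ = x′ ∧ y′

  x∧Q≤a₁∨a₂ : x ∧ Q ≤ a₁ ∨ a₂
  x∧Q≤a₁∨a₂ = ≤-reflexive (proj₁ commute)

  y∧P≤a₁∨a₃ : y ∧ P ≤ a₁ ∨ a₃
  y∧P≤a₁∨a₃ = ≤-reflexive (proj₁ (proj₂ commute)) ⟫ ∨-monotonic ∧-comm≤ ∧-comm≤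

  p≤p∧y∨p∧y′ : p ≤ (p ∧ y) ∨ (p ∧ y′)
  p≤p∧y∨p∧y′ = ≤-reflexive (proj₂ (proj₂ commute))

  -- Modularity propagates commutation: y′∧P≤a₂∨a₄ is (C2) for the pair (x, y′), and
  -- q≤x∧q∨x′∧q is (C3) for the pair (y, x).
  [x∨y′]∧[x′∨y′]≤y′∨p : (x ∨ y′) ∧ (x′ ∨ y′) ≤ y′ ∨ p
  [x∨y′]∧[x′∨y′]≤y′∨p =
    ∧-comm≤ ⟫ ∧-monotonic ′-∧≥ (∨-monotonic x≤x′′ ≤-refl ⟫ ′-∧≥) ⟫ ′-∨≥ ⟫ antitone y∧P≤a₁∨a₃
    ⟫ ′-∧≤ ⟫ ∨-monotonic ≤-refl (≤-reflexive ′-x∨x′)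

  y′∧P≤a₂∨a₄ : y′ ∧ P ≤ a₂ ∨ a₄
  y′∧P≤a₂∨a₄ =
    ∧-greatest x∧y≤x
      (≤∨-refine {b = x′} x∧y≤y step ⟫ ∨-least y≤x∨y (∨-least (x∧y≤x ⟫ y≤x∨y) x≤x∨y))
    ⟫ ∧-comm≤ ⟫ modular≤ x∧y≤y ⟫ ∨-comm≤
    where
    step : (x ∨ (y′ ∧ P)) ∧ x′ ≤ p ∨ a₄
    step = ∧-greatest (∧-greatest (x∧y≤x ⟫ ∨-monotonic ≤-refl x∧y≤x) (x∧y≤y ⟫ x≤x∨y)) x∧y≤y
           ⟫ ∧-monotonic [x∨y′]∧[x′∨y′]≤y′∨p ≤-refl
           ⟫ ∧-monotonic ∨-comm≤ ≤-refl ⟫ modular≤ x∧y≤y ⟫ ∨-monotonic ≤-refl ∧-comm≤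

  [P∨y′]∧[P∨y]≤P : (P ∨ y′) ∧ (P ∨ y) ≤ P
  [P∨y′]∧[P∨y]≤P =
    ∧-monotonic (∨-monotonic P≤p′ ≤-refl ⟫ ′-∧≥) (∨-monotonic P≤p′ x≤x′′ ⟫ ′-∧≥) ⟫ ′-∨≥
    ⟫ antitone p≤p∧y∨p∧y′ ⟫ ≤-reflexive ′-x∧x′
    where
    P≤p′ : P ≤ p ′
    P≤p′ = ≤-reflexive (sym ′-x∧x′)

  P∧Q≤y∨a₂∨a₄ : P ∧ Q ≤ y ∨ (a₂ ∨ a₄)
  P∧Q≤y∨a₂∨a₄ = ≤∨-refine {b = y′} x∧y≤y step
    where
    step : (y ∨ (P ∧ Q)) ∧ y′ ≤ a₂ ∨ a₄
    step = ∧-greatest (∧-greatest (x∧y≤y ⟫ y≤x∨y) (x∧y≤x ⟫ ∨-least y≤x∨y (x∧y≤x ⟫ x≤x∨y))) x∧y≤y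
           ⟫ ∧-monotonic [P∨y′]∧[P∨y]≤P ≤-refl ⟫ ∧-comm≤ ⟫ y′∧P≤a₂∨a₄

  [x∨y]∧[x′∨y]≤y∨p : (x ∨ y) ∧ (x′ ∨ y) ≤ y ∨ p
  [x∨y]∧[x′∨y]≤y∨p =
    ∧-monotonic (∨-monotonic x≤x′′ x≤x′′ ⟫ ′-∧≥) (∨-monotonic ≤-refl x≤x′′ ⟫ ′-∧≥) ⟫ ∧-comm≤ ⟫ ′-∨≥
    ⟫ antitone y′∧P≤a₂∨a₄ ⟫ ′-∧≤ ⟫ ∨-monotonic x′′≤x (≤-reflexive ′-x∨x′)

  [y∨p]∧[y′∨p]≤p∨q : (y ∨ p) ∧ (y′ ∨ p) ≤ p ∨ q
  [y∨p]∧[y′∨p]≤p∨q =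
    ∧-monotonic (∨-least y≤x∨y (p≤p∧y∨p∧y′ ⟫ ∨-least (x∧y≤y ⟫ y≤x∨y) x≤x∨y))
                (∨-least x≤x∨y (p≤p∧y∨p∧y′ ⟫ ∨-least y≤x∨y (x∧y≤y ⟫ x≤x∨y)))
    ⟫ modular≤ (x∧y≤y ⟫ x≤x∨y)
    ⟫ ∨-monotonic ≤-refl (∧-comm≤ ⟫ ∧-monotonic ∨-comm≤ ≤-refl ⟫ modular≤ x∧y≤y)
    ⟫ ∨-least (x∧y≤x ⟫ x≤x∨y) (∨-least (x∧y≤x ⟫ x≤x∨y) (∧-comm≤ ⟫ y≤x∨y))

  q≤x∧q∨x′∧q : q ≤ (x ∧ q) ∨ (x′ ∧ q)
  q≤x∧q∨x′∧q =
    ∧-greatest ≤-refl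
      (≤∨-refine {b = x′} (kleene y x) step ⟫ ∨-least y≤x∨y (∨-least (x∧y≤x ⟫ y≤x∨y) x≤x∨y))
    ⟫ ∧-comm≤ ⟫ modular≤ x∧y≤y ⟫ ∨-comm≤
    where
    step : (x ∨ q) ∧ x′ ≤ p ∨ (x′ ∧ q)
    step = ∧-greatest
             (∧-greatest (∧-greatest (x∧y≤x ⟫ ∨-monotonic ≤-refl x∧y≤x) (x∧y≤y ⟫ x≤x∨y))
                         (∧-greatest (x∧y≤x ⟫ ∨-monotonic ≤-refl x∧y≤y) (x∧y≤y ⟫ x≤x∨y)))
             x∧y≤y
           ⟫ ∧-monotonic
               (∧-monotonic [x∨y]∧[x′∨y]≤y∨p [x∨y′]∧[x′∨y′]≤y′∨p ⟫ [y∨p]∧[y′∨p]≤p∨q) ≤-refl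
           ⟫ modular≤ x∧y≤y ⟫ ∨-monotonic ≤-refl ∧-comm≤

  open Representation A modular

  -- dₖ marks the generators after the k-th one that lie below it.
  d₀  : Subset 13
  d₀  = full
  d₁  : Subset 12
  d₁  = false ∷ false ∷ false ∷ true ∷ false ∷ true ∷ false ∷ true ∷ true ∷ true ∷ false ∷ true ∷ []
  d₂  : Subset 11
  d₂  = false ∷ false ∷ false ∷ true ∷ false ∷ true ∷ true ∷ true ∷ false ∷ true ∷ true ∷ []
  d₃  : Subset 10
  d₃  = false ∷ true ∷ true ∷ false ∷ false ∷ true ∷ false ∷ true ∷ true ∷ true ∷ []
  d₄  : Subset 9
  d₄  = false ∷ false ∷ true ∷ true ∷ false ∷ true ∷ true ∷ true ∷ true ∷ []
  d₅  : Subset 8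
  d₅  = false ∷ false ∷ false ∷ true ∷ false ∷ true ∷ false ∷ true ∷ []
  d₆  : Subset 7
  d₆  = false ∷ false ∷ true ∷ false ∷ false ∷ true ∷ true ∷ []
  d₇  : Subset 6
  d₇  = false ∷ false ∷ true ∷ true ∷ false ∷ true ∷ []
  d₈  : Subset 5
  d₈  = false ∷ true ∷ false ∷ true ∷ true ∷ []
  d₉  : Subset 4
  d₉  = false ∷ false ∷ false ∷ true ∷ []
  d₁₀ : Subset 3
  d₁₀ = false ∷ false ∷ true ∷ []
  d₁₁ : Subset 2
  d₁₁ = false ∷ true ∷ []
  d₁₂ : Subset 1
  d₁₂ = true ∷ []
  d₁₃ : Subset 0
  d₁₃ = []

  gens₁₄ : Family 0
  gens₁₄ = []
  gens₁₃ : Family 1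
  gens₁₃ = p ∧ q ⟨ d₁₃ ⟩∷ gens₁₄
  gens₁₂ : Family 2
  gens₁₂ = p ∧ y ⟨ d₁₂ ⟩∷ gens₁₃
  gens₁₁ : Family 3
  gens₁₁ = p ∧ y′ ⟨ d₁₁ ⟩∷ gens₁₂
  gens₁₀ : Family 4
  gens₁₀ = x ∧ q ⟨ d₁₀ ⟩∷ gens₁₁
  gens₉ : Family 5
  gens₉ = x′ ∧ q ⟨ d₉ ⟩∷ gens₁₀
  gens₈ : Family 6
  gens₈ = a₁ ⟨ d₈ ⟩∷ gens₉
  gens₇ : Family 7
  gens₇ = a₂ ⟨ d₇ ⟩∷ gens₈
  gens₆ : Family 8
  gens₆ = a₃ ⟨ d₆ ⟩∷ gens₇
  gens₅ : Family 9
  gens₅ = a₄ ⟨ d₅ ⟩∷ gens₆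
  gens₄ : Family 10
  gens₄ = x ⟨ d₄ ⟩∷ gens₅
  gens₃ : Family 11
  gens₃ = x′ ⟨ d₃ ⟩∷ gens₄
  gens₂ : Family 12
  gens₂ = y ⟨ d₂ ⟩∷ gens₃
  gens₁ : Family 13
  gens₁ = y′ ⟨ d₁ ⟩∷ gens₂
  gens : Family 14
  gens = ⊤ ⟨ d₀ ⟩∷ gens₁

  p∧q-coherent : HeadCoherent gens₁₃
  p∧q-coherent = x∧y≤y

  p∧y-coherent : HeadCoherent gens₁₂
  p∧y-coherent = x∧y≤y

  p∧y′-coherent : HeadCoherent gens₁₁
  p∧y′-coherent =
    ∧-monotonic ≤-refl (⋁-least gens₁₂ full
        ( ≤-refl , (∧-monotonic ≤-refl x∧y≤x) , tt))
    ⟫ ∧-greatest (x∧y≤x ⟫ x∧y≤x) (∧-greatest (x∧y≤y ⟫ x∧y≤y) (x∧y≤x ⟫ x∧y≤y))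
    ⟫ ⋁-upper-at gens₁₂ d₁₁ (# 1)

  x∧q-coherent : HeadCoherent gens₁₀
  x∧q-coherent =
    ∧-monotonic ≤-refl (⋁-least gens₁₁ full
        ( x∧y≤x , x∧y≤x , x∧y≤x , tt))
    ⟫ ∧-greatest x∧y≤y (x∧y≤x ⟫ x∧y≤y) ⟫ ⋁-upper-at gens₁₁ d₁₀ (# 2)

  x′∧q-coherent : HeadCoherent gens₉
  x′∧q-coherent =
    ∧-monotonic ≤-refl (⋁-least gens₁₀ full
        ( x∧y≤x , (x∧y≤x ⟫ x∧y≤x) , (x∧y≤x ⟫ x∧y≤x) , (x∧y≤x ⟫ x∧y≤x) , tt))
    ⟫ ∧-greatest (∧-greatest x∧y≤y (x∧y≤x ⟫ x∧y≤x)) (x∧y≤x ⟫ x∧y≤y) ⟫ ⋁-upper-at gens₁₀ d₉ (# 3)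

  a₁-coherent : HeadCoherent gens₈
  a₁-coherent =
    ∧-monotonic ≤-refl (⋁-least gens₉ full
        ( y≤x∨y , (y≤x∨y ⟫ x≤x∨y) , (x∧y≤x ⟫ x≤x∨y ⟫ x≤x∨y) , (x∧y≤x ⟫ x≤x∨y ⟫ x≤x∨y)
        , (x∧y≤x ⟫ x≤x∨y ⟫ x≤x∨y) , tt))
    ⟫ ∧-greatest x∧y≤x (∧-greatest x∧y≤y (x∧y≤x ⟫ x∧y≤x) ⟫ modular≤ (∨-least x∧y≤x x∧y≤x))
    ⟫ ∧-monotonic ≤-refl (∨-least (∨-least y≤x∨y x≤x∨y) (∧-greatest x∧y≤y (x∧y≤x ⟫ x∧y≤x) ⟫ y≤x∨y))
    ⟫ ∧-comm≤ ⟫ modular≤ (∧-monotonic ≤-refl x∧y≤x) ⟫ ∨-monotonic ≤-refl (∧-monotonic ≤-refl x∧y≤y)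
    ⟫ ∨-least (⋁-upper-at gens₉ d₈ (# 1)) (⋁-upper-at gens₉ d₈ (# 3))

  a₂-coherent : HeadCoherent gens₇
  a₂-coherent =
    ∧-monotonic ≤-refl (⋁-least gens₈ full
        ( (x≤x∨y ⟫ x≤x∨y) , y≤x∨y , (∧-monotonic ≤-refl x∧y≤x ⟫ x≤x∨y ⟫ x≤x∨y)
        , (x∧y≤x ⟫ y≤x∨y ⟫ x≤x∨y) , (x∧y≤x ⟫ y≤x∨y ⟫ x≤x∨y) , (x∧y≤x ⟫ y≤x∨y ⟫ x≤x∨y) , tt))
    ⟫ ∧-greatest x∧y≤x (∧-greatest x∧y≤y (x∧y≤x ⟫ x∧y≤x) ⟫ modular≤ (∨-least x∧y≤x x∧y≤x))
    ⟫ ∧-monotonic ≤-refl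
        (∨-least (∨-least y≤x∨y (p≤p∧y∨p∧y′ ⟫ ∨-least (∧-monotonic x∧y≤x ≤-refl ⟫ y≤x∨y) x≤x∨y))
                 (∧-greatest x∧y≤y (x∧y≤x ⟫ x∧y≤x) ⟫ p≤p∧y∨p∧y′
                  ⟫ ∨-least (∧-monotonic x∧y≤x ≤-refl ⟫ y≤x∨y) x≤x∨y))
    ⟫ ∧-comm≤ ⟫ modular≤ (∧-monotonic x∧y≤x ≤-refl)
    ⟫ ∨-monotonic ≤-refl (∧-greatest (x∧y≤x ⟫ x∧y≤x) (∧-greatest (x∧y≤x ⟫ x∧y≤y) (x∧y≤y ⟫ x∧y≤y)))
    ⟫ ∨-least (⋁-upper-at gens₈ d₇ (# 3)) (⋁-upper-at gens₈ d₇ (# 2))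

  a₃-coherent : HeadCoherent gens₆
  a₃-coherent =
    ∧-monotonic ≤-refl (⋁-least gens₇ full
        ( (y≤x∨y ⟫ x≤x∨y ⟫ y≤x∨y) , (x≤x∨y ⟫ x≤x∨y ⟫ y≤x∨y) , x≤x∨y
        , (∧-monotonic ≤-refl x∧y≤x ⟫ x≤x∨y ⟫ x≤x∨y ⟫ y≤x∨y) , (x∧y≤x ⟫ y≤x∨y ⟫ y≤x∨y)
        , (x∧y≤x ⟫ y≤x∨y ⟫ y≤x∨y) , (x∧y≤x ⟫ y≤x∨y ⟫ y≤x∨y) , tt))
    ⟫ ∧-comm≤ ⟫ modular≤ (∧-monotonic ≤-refl x∧y≤x)
    ⟫ ∨-monotonic ≤-refl
        (∧-greatest (∧-greatest (x∧y≤x ⟫ ∨-least (∨-least x∧y≤x x∧y≤x) x∧y≤x) (x∧y≤y ⟫ x∧y≤x))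
                    (x∧y≤y ⟫ x∧y≤y))
    ⟫ ∨-least (⋁-upper-at gens₇ d₆ (# 2)) (⋁-upper-at gens₇ d₆ (# 5))

  a₄-coherent : HeadCoherent gens₅
  a₄-coherent =
    ∧-monotonic ≤-refl (⋁-least gens₆ full
        ( x≤x∨y , (y≤x∨y ⟫ x≤x∨y ⟫ y≤x∨y) , (x≤x∨y ⟫ x≤x∨y ⟫ y≤x∨y)
        , (∧-monotonic ≤-refl x∧y≤x ⟫ x≤x∨y) , (∧-monotonic ≤-refl x∧y≤x ⟫ x≤x∨y ⟫ x≤x∨y ⟫ y≤x∨y)
        , (x∧y≤x ⟫ y≤x∨y ⟫ y≤x∨y) , (x∧y≤x ⟫ y≤x∨y ⟫ y≤x∨y) , (x∧y≤x ⟫ y≤x∨y ⟫ y≤x∨y) , tt))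
    ⟫ ∧-greatest x∧y≤x (∧-greatest x∧y≤y (x∧y≤x ⟫ x∧y≤x) ⟫ modular≤ x∧y≤x)
    ⟫ ∧-monotonic ≤-refl
        (∨-least y≤x∨y (∧-greatest (x∧y≤x ⟫ ∨-least (∨-least x∧y≤x x∧y≤x) x∧y≤x) x∧y≤y
                        ⟫ p≤p∧y∨p∧y′ ⟫ ∨-least (∧-monotonic x∧y≤y ≤-refl ⟫ y≤x∨y) x≤x∨y))
    ⟫ ∧-comm≤ ⟫ modular≤ (∧-monotonic x∧y≤y ≤-refl)
    ⟫ ∨-monotonic ≤-refl (∧-greatest (x∧y≤x ⟫ x∧y≤x) (∧-greatest (x∧y≤x ⟫ x∧y≤y) (x∧y≤y ⟫ x∧y≤y)))
    ⟫ ∨-least (⋁-upper-at gens₆ d₅ (# 5)) (⋁-upper-at gens₆ d₅ (# 3))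

  x-coherent : HeadCoherent gens₄
  x-coherent =
    ∧-monotonic ≤-refl (⋁-least gens₅ full
        ( (x∧y≤y ⟫ y≤x∨y) , (x∧y≤y ⟫ x≤x∨y) , (x∧y≤y ⟫ y≤x∨y) , (x∧y≤y ⟫ x≤x∨y)
        , (x∧y≤y ⟫ x∧y≤x ⟫ x≤x∨y) , (x∧y≤y ⟫ x∧y≤x ⟫ x≤x∨y) , (x∧y≤y ⟫ y≤x∨y) , (x∧y≤y ⟫ x≤x∨y)
        , (x∧y≤y ⟫ x∧y≤x ⟫ x≤x∨y) , tt))
    ⟫ x∧Q≤a₁∨a₂ ⟫ ∨-least (⋁-upper-at gens₅ d₄ (# 3)) (⋁-upper-at gens₅ d₄ (# 2))

  x′-coherent : HeadCoherent gens₃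
  x′-coherent =
    ∧-monotonic ≤-refl (⋁-least gens₄ full
        ( x≤x∨y , (y≤x∨y ⟫ y≤x∨y) , (x≤x∨y ⟫ y≤x∨y) , (x∧y≤x ⟫ x≤x∨y) , (x∧y≤x ⟫ x≤x∨y)
        , (∧-monotonic ≤-refl x∧y≤x ⟫ x≤x∨y ⟫ y≤x∨y) , (x∧y≤x ⟫ x≤x∨y) , (x∧y≤x ⟫ x∧y≤x ⟫ x≤x∨y)
        , (x∧y≤x ⟫ x∧y≤x ⟫ x≤x∨y) , (x∧y≤x ⟫ x∧y≤x ⟫ x≤x∨y) , tt))
    ⟫ ∧-comm≤ ⟫ ∧-monotonic ∨-comm≤ ≤-refl ⟫ modular≤ (∨-least x∧y≤x x∧y≤x)
    ⟫ ∨-monotonic ≤-refl p≤p∧y∨p∧y′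
    ⟫ ∨-least (∨-least (⋁-upper-at gens₄ d₃ (# 2)) (⋁-upper-at gens₄ d₃ (# 1)))
        (∨-least (⋁-upper-at gens₄ d₃ (# 8)) (⋁-upper-at gens₄ d₃ (# 7)))

  y-coherent : HeadCoherent gens₂
  y-coherent =
    ∧-monotonic ≤-refl (⋁-least gens₃ full
        ( y≤x∨y , x≤x∨y , (x∧y≤x ⟫ y≤x∨y) , (x∧y≤x ⟫ y≤x∨y) , (x∧y≤x ⟫ x≤x∨y) , (x∧y≤x ⟫ x≤x∨y)
        , (x∧y≤x ⟫ y≤x∨y) , (x∧y≤x ⟫ x≤x∨y) , (x∧y≤x ⟫ x∧y≤x ⟫ x≤x∨y) , (x∧y≤x ⟫ x∧y≤x ⟫ x≤x∨y)
        , (x∧y≤x ⟫ x∧y≤x ⟫ x≤x∨y) , tt))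
    ⟫ y∧P≤a₁∨a₃ ⟫ ∨-least (⋁-upper-at gens₃ d₂ (# 5)) (⋁-upper-at gens₃ d₂ (# 3))

  y′-coherent : HeadCoherent gens₁
  y′-coherent =
    ∧-monotonic ≤-refl (⋁-least gens₂ full
        ( x≤x∨y , (y≤x∨y ⟫ y≤x∨y) , (x≤x∨y ⟫ y≤x∨y) , (x∧y≤x ⟫ y≤x∨y ⟫ y≤x∨y)
        , (x∧y≤x ⟫ y≤x∨y ⟫ y≤x∨y) , (x∧y≤x ⟫ x≤x∨y ⟫ y≤x∨y) , (x∧y≤x ⟫ x≤x∨y ⟫ y≤x∨y)
        , (x∧y≤x ⟫ y≤x∨y ⟫ y≤x∨y) , (x∧y≤x ⟫ x≤x∨y ⟫ y≤x∨y) , (x∧y≤x ⟫ x∧y≤x ⟫ x≤x∨y ⟫ y≤x∨y)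
        , (x∧y≤x ⟫ x∧y≤x ⟫ x≤x∨y ⟫ y≤x∨y) , (x∧y≤x ⟫ x∧y≤x ⟫ x≤x∨y ⟫ y≤x∨y) , tt))
    ⟫ ∧-greatest x∧y≤x (∧-greatest x∧y≤y (x∧y≤x ⟫ y≤x∨y))
    ⟫ ∧-monotonic ≤-refl (modular≤ x≤x∨y ⟫ ∨-least x≤x∨y P∧Q≤y∨a₂∨a₄)
    ⟫ ∧-comm≤ ⟫ ∧-monotonic ∨-comm≤ ≤-refl ⟫ modular≤ (∨-least x∧y≤y x∧y≤y)
    ⟫ ∨-monotonic ≤-refl q≤x∧q∨x′∧q
    ⟫ ∨-least (∨-least (⋁-upper-at gens₂ d₁ (# 5)) (⋁-upper-at gens₂ d₁ (# 3)))
        (∨-least (⋁-upper-at gens₂ d₁ (# 8)) (⋁-upper-at gens₂ d₁ (# 7)))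

  ⊤-coherent : HeadCoherent gens
  ⊤-coherent = x∧y≤y

  coherent : Coherent gens
  coherent = ⊤-coherent , y′-coherent , y-coherent , x′-coherent , x-coherent
           , a₄-coherent , a₃-coherent , a₂-coherent , a₁-coherent
           , x′∧q-coherent , x∧q-coherent , p∧y′-coherent , p∧y-coherent , p∧q-coherent , tt

  ⊤≤⋁full : ⊤ ≤ ⋁ gens full
  ⊤≤⋁full = ⋁-upper gens full here

  open Representing gens coherent ⊤≤⋁full

  below-x below-x′ below-y below-y′ : Subset 14
  below-x  = false ∷ false ∷ false ∷ false ∷ true ∷ false ∷ false
           ∷ true ∷ true ∷ false ∷ true ∷ true ∷ true ∷ true ∷ []
  below-x′ = false ∷ false ∷ false ∷ true ∷ false ∷ true ∷ true
           ∷ false ∷ false ∷ true ∷ false ∷ true ∷ true ∷ true ∷ []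
  below-y  = false ∷ false ∷ true ∷ false ∷ false ∷ false ∷ true
           ∷ false ∷ true ∷ true ∷ true ∷ false ∷ true ∷ true ∷ []
  below-y′ = false ∷ true ∷ false ∷ false ∷ false ∷ true ∷ false
           ∷ true ∷ false ∷ true ∷ true ∷ true ∷ false ∷ true ∷ []

  x-rep : Represented x
  x-rep = Represented-member below-x (# 4)
    (≤-refl , x∧y≤x , x∧y≤x , x∧y≤x , (x∧y≤x ⟫ x∧y≤x) , (x∧y≤x ⟫ x∧y≤x) , (x∧y≤x ⟫ x∧y≤x) , tt)

  x′-rep : Represented x′
  x′-rep = Represented-member below-x′ (# 3)
    (≤-refl , x∧y≤x , x∧y≤x , x∧y≤x , (x∧y≤x ⟫ x∧y≤y) , (x∧y≤x ⟫ x∧y≤y) , (x∧y≤x ⟫ x∧y≤y) , tt)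

  y-rep : Represented y
  y-rep = Represented-member below-y (# 2)
    (≤-refl , x∧y≤y , x∧y≤y , (x∧y≤y ⟫ x∧y≤x) , (x∧y≤y ⟫ x∧y≤x) , x∧y≤y , (x∧y≤y ⟫ x∧y≤x) , tt)

  y′-rep : Represented y′
  y′-rep = Represented-member below-y′ (# 1)
    (≤-refl , x∧y≤y , x∧y≤y , (x∧y≤y ⟫ x∧y≤y) , (x∧y≤y ⟫ x∧y≤y) , x∧y≤y , (x∧y≤y ⟫ x∧y≤y) , tt)

  complements : ComplementsRepresented gens
  complements =
      Represented-resp (sym ⊤′≈⊥) Represented-⊥ , y′′-rep , y′-rep , x′′-rep , x′-rep
    , Represented-′∧ x′′-rep y′′-rep , Represented-′∧ x′′-rep y′-rep
    , Represented-′∧ x′-rep y′′-rep , Represented-′∧ x′-rep y′-rep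
    , Represented-′∧ x′′-rep q′-rep , Represented-′∧ x′-rep q′-rep
    , Represented-′∧ p′-rep y′′-rep , Represented-′∧ p′-rep y′-rep
    , Represented-′∧ p′-rep q′-rep , tt
    where
    x′′-rep : Represented (x′ ′)
    x′′-rep = Represented-resp (sym (involutive x)) x-rep
    y′′-rep : Represented (y′ ′)
    y′′-rep = Represented-resp (sym (involutive y)) y-rep
    p′-rep : Represented (p ′)
    p′-rep = Represented-′∧ x′-rep x′′-rep
    q′-rep : Represented (q ′)
    q′-rep = Represented-′∧ y′-rep y′′-rep

  sg-isKleene : SgIsKleene A x y
  sg-isKleene = sgIsKleene complements x-rep y-rep

commute⇒SgIsKleene : ∀ {c ℓ} (A : PseudoKleeneLattice c ℓ) → IsModular A →
                     ∀ x y → _C_ A x y → SgIsKleene A x y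
commute⇒SgIsKleene A modular x y commute = Commuting.sg-isKleene A modular x y commute

SgIsKleene⇒commute : ∀ {c ℓ} (A : PseudoKleeneLattice c ℓ) →
                     ∀ x y → SgIsKleene A x y → _C_ A x y
SgIsKleene⇒commute A x y distrib =
    distrib x y (y ′) (var₀ , refl) (var₁ , refl) (var₁ ′ₜ , refl)
  , distrib y x (x ′) (var₁ , refl) (var₀ , refl) (var₀ ′ₜ , refl)
  , trans (sym (kleene x y))
      (distrib (x ∧ x ′) y (y ′) (var₀ ∧ₜ (var₀ ′ₜ) , refl) (var₁ , refl) (var₁ ′ₜ , refl))
  where open PseudoKleeneLattice A

theorem4p14 : {c ℓ : Level} (A : PseudoKleeneLattice c ℓ) → IsModular A →
    (x y : PseudoKleeneLattice.Carrier A) → (_C_ A x y ⇔ SgIsKleene A x y)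
theorem4p14 A modular x y = mk⇔ (commute⇒SgIsKleene A modular x y) (SgIsKleene⇒commute A x y)
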